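{- Let $m$ be a positive integer, let $S\subseteq\mathbb R_{>0}^m$ be an intervallic subspace, and let $0\le a,b<m$ be integers. Then there exists an intervallic subspace $S'\subseteq\mathbb R_{>0}^{m+3}$ such that the canonical projection $\pi_{m+3,m}$ restricts to a linear isomorphism $S'\to S$ and every $v=(v_0,\dots,v_{m+2})\in S'$ satisfies $v_{m+2}=v_a+v_b$.
   Context: Coordinates on $\mathbb R^k$ are indexed $v=(v_0,\dots,v_{k-1})$. For $k'\ge k$, $\pi_{k',k}:\mathbb R^{k'}\to\mathbb R^k$ is the projection to the first $k$ coordinates. A tuple of integers $(a',b',a,b)$ is admissible if $a<b$, $a'<b'$, $a'<a$ and $b'<b$. A subset $S\subseteq\mathbb R_{>0}^k$ is intervallic if there is a finite set $I$ of admissible tuples with entries in $\{0,\dots,k\}$ such that $S$ is exactly the set of $v\in\mathbb R_{>0}^k$ satisfying $\sum_{a\le j<b}v_j=\sum_{a'\le j<b'}v_j$ for all $(a',b',a,b)\in I$. -}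

module Defs where

open import Level using (0ℓ)
open import Data.Nat as ℕ using (ℕ; zero; suc)
open import Data.Bool using (if_then_else_; _∧_)
open import Data.Fin using (Fin; toℕ)
open import Data.Product using (Σ; ∃; _×_; _,_)
open import Data.Sum using (_⊎_)
open import Data.List using (List)
open import Data.List.Relation.Unary.All using (All)
open import Relation.Binary.PropositionalEquality using (_≡_)
open import Relation.Binary.Core using (Rel)
open import Relation.Binary.Structures using (IsStrictTotalOrder)
open import Relation.Nullary using (¬_)
open import Algebra.Structures using (IsCommutativeRing)
open import Function using (_∘_)

-- The real numbers, axiomatised (classically, uniquely up to isomorphism)
-- as a complete ordered field.  Equality is propositional equality.
record RealNumbers : Set₁ where
  infixl 6 _+_
  infixl 7 _*_
  infix 4 _<_ _≤_
  field
    Carrier : Set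
    _+_ _*_ : Carrier → Carrier → Carrier
    -_ : Carrier → Carrier
    0# 1# : Carrier
    isCommutativeRing : IsCommutativeRing _≡_ _+_ _*_ -_ 0# 1#
    0≢1 : ¬ (0# ≡ 1#)
    inverse : ∀ x → ¬ (x ≡ 0#) → ∃ λ y → x * y ≡ 1#
    _<_ : Rel Carrier 0ℓ
    isStrictTotalOrder : IsStrictTotalOrder _≡_ _<_
    +-monoˡ-< : ∀ {x y} z → x < y → x + z < y + z
    *-pos : ∀ {x y} → 0# < x → 0# < y → 0# < x * y

  _≤_ : Rel Carrier 0ℓ
  x ≤ y = x < y ⊎ x ≡ y

  field
    sup : (P : Carrier → Set) → ∃ P → (∃ λ u → ∀ x → P x → x ≤ u) →
          ∃ λ s → (∀ x → P x → x ≤ s) × (∀ u → (∀ x → P x → x ≤ u) → s ≤ u)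

module _ (R : RealNumbers) where
  open RealNumbers R

  Vect : ℕ → Set
  Vect k = Fin k → Carrier

  _≋_ : ∀ {k} → Vect k → Vect k → Set
  v ≋ w = ∀ i → v i ≡ w i

  sumFin : ∀ {k} → Vect k → Carrier
  sumFin {zero} f = 0#
  sumFin {suc k} f = f Fin.zero + sumFin (f ∘ Fin.suc)

  intervalSum : ∀ {k} → Vect k → ℕ → ℕ → Carrier
  intervalSum v a b = sumFin (λ j → if (a ℕ.≤ᵇ toℕ j) ∧ (toℕ j ℕ.<ᵇ b) then v j else 0#)

  Positive : ∀ {k} → Vect k → Set
  Positive v = ∀ i → 0# < v i

  record Tuple : Set where
    constructor tup
    field
      a' b' a b : ℕ

  AdmissibleIn : ℕ → Tuple → Set
  AdmissibleIn k (tup a' b' a b) =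
    (a ℕ.< b) × (a' ℕ.< b') × (a' ℕ.< a) × (b' ℕ.< b) ×
    (a' ℕ.≤ k) × (b' ℕ.≤ k) × (a ℕ.≤ k) × (b ℕ.≤ k)

  SatisfiesTuple : ∀ {k} → Vect k → Tuple → Set
  SatisfiesTuple v (tup a' b' a b) = intervalSum v a b ≡ intervalSum v a' b'

  IsIntervallic : (k : ℕ) → (Vect k → Set) → Set
  IsIntervallic k S =
    Σ (List Tuple) λ I → All (AdmissibleIn k) I ×
      (∀ v → (S v → Positive v × All (SatisfiesTuple v) I)
           × (Positive v × All (SatisfiesTuple v) I → S v))

  proj : ∀ {k} n → Vect (k ℕ.+ n) → Vect k
  proj n v i = v (i Data.Fin.↑ˡ n)

module Submission where

-- Given S = { v > 0 | the tuples of I hold }, append three new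
-- coordinates at positions m, m+1, m+2 and impose three more tuples:
--   [m, m+1) = [a, a+1),   [m+1, m+2) = [b, b+1),   [m+2, m+3) = [m, m+2),
-- i.e. v_m = v_a, v_{m+1} = v_b and v_{m+2} = v_m + v_{m+1}.  Together with
-- the old tuples (which only involve the first m coordinates) this cuts out
-- S' ⊆ R_{>0}^{m+3}; on S' the new coordinates are determined by the old
-- ones, so π is injective on S', and every u ∈ S lifts to
-- u ++ (u_a, u_b, u_a + u_b) ∈ S'.

open import Defs
open import Data.Nat using (ℕ; zero; suc; _+_; _≤_)
open import Data.Fin as Fin using (Fin; _↑ˡ_; _↑ʳ_)
open import Data.Product using (Σ; _×_; _,_; proj₁; proj₂)
open import Relation.Binary.PropositionalEquality using (_≡_)

open import Level using (0ℓ)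
open import Data.Nat using (_<?_; _<_; _≤ᵇ_; _<ᵇ_; z≤n; s≤s)
open import Data.Nat.Properties
  using (+-monoˡ-≤; ≤-reflexive; n≤1+n; ≮⇒≥; ≤⇒≤ᵇ; ≤ᵇ⇒≤; <⇒<ᵇ; <ᵇ⇒<; <⇒≱; <⇒≤; ≤-refl; ≤-trans; <-≤-trans; <-cmp; m≤m+n; m≤n+m; +-comm)
open import Data.Fin using (toℕ; splitAt; join)
open import Data.Fin.Properties using (toℕ-↑ˡ; toℕ-↑ʳ; toℕ<n; toℕ-injective; join-splitAt; punchInᵢ≢i)
open import Data.Bool using (Bool; true; false; T; if_then_else_; _∧_)
open import Data.Bool.Properties using (T-≡; ∧-zeroʳ)
open import Data.Sum using (inj₁; inj₂)
open import Data.Empty using (⊥-elim)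
open import Data.List using (List; []; _∷_; _++_)
open import Data.List.Relation.Unary.All as All using (All; []; _∷_)
open import Data.List.Relation.Unary.All.Properties using (++⁺; ++⁻ˡ; ++⁻ʳ)
import Data.Vec.Functional as Vector
open import Data.Vec.Functional.Properties using (lookup-++ˡ; lookup-++ʳ)
open import Relation.Nullary using (¬_; yes; no)
open import Relation.Binary.Definitions using (tri<; tri≈; tri>)
open import Relation.Binary.PropositionalEquality using (refl; sym; trans; cong; cong₂; subst; _≢_; module ≡-Reasoning)
open import Function using (_∘_; _⇔_; mk⇔; Equivalence)
open import Algebra.Bundles using (CommutativeMonoid)
open import Algebra.Structures using (IsCommutativeRing)
open import Relation.Binary.Structures using (IsStrictTotalOrder)
import Algebra.Properties.CommutativeMonoid.Sum as MonoidSum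

open Equivalence using (to; from)

χ : ℕ → ℕ → ℕ → Bool
χ A B x = (A ≤ᵇ x) ∧ (x <ᵇ B)

true-if-T : ∀ {c} → T c → c ≡ true
true-if-T = Equivalence.to T-≡

false-if-¬T : ∀ {c} → ¬ T c → c ≡ false
false-if-¬T {false} _  = refl
false-if-¬T {true}  ¬t = ⊥-elim (¬t _)

≤ᵇ-true : ∀ {A x} → A ≤ x → (A ≤ᵇ x) ≡ true
≤ᵇ-true = true-if-T ∘ ≤⇒≤ᵇ

<ᵇ-true : ∀ {x B} → x < B → (x <ᵇ B) ≡ true
<ᵇ-true = true-if-T ∘ <⇒<ᵇ

χ-inside : ∀ A B {x} → A ≤ x → x < B → χ A B x ≡ true
χ-inside A B A≤x x<B rewrite ≤ᵇ-true A≤x | <ᵇ-true x<B = refl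

χ-below : ∀ A B {x} → x < A → χ A B x ≡ false
χ-below A B {x} x<A rewrite false-if-¬T {A ≤ᵇ x} (<⇒≱ x<A ∘ ≤ᵇ⇒≤ A x) = refl

χ-above : ∀ A B {x} → B ≤ x → χ A B x ≡ false
χ-above A B {x} B≤x
  rewrite false-if-¬T {x <ᵇ B} (λ t → <⇒≱ (<ᵇ⇒< x B t) B≤x) = ∧-zeroʳ (A ≤ᵇ x)

χ-same-right : ∀ {A B C x} → x < B → x < C → χ A C x ≡ χ A B x
χ-same-right {A} {x = x} x<B x<C = cong ((A ≤ᵇ x) ∧_) (trans (<ᵇ-true x<C) (sym (<ᵇ-true x<B)))

χ-same-left : ∀ {A B C x} → A ≤ x → B ≤ x → χ B C x ≡ χ A C x
χ-same-left {C = C} {x} A≤x B≤x = cong (_∧ (x <ᵇ C)) (trans (≤ᵇ-true B≤x) (sym (≤ᵇ-true A≤x)))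

module _ (R : RealNumbers) where
  open RealNumbers R using (Carrier; 0#; isCommutativeRing; isStrictTotalOrder; +-monoˡ-<)
    renaming (_+_ to _⊕_; _<_ to _<ᴿ_)
  open IsCommutativeRing isCommutativeRing using (+-identityˡ; +-identityʳ; +-assoc; +-isCommutativeMonoid)
  open IsStrictTotalOrder isStrictTotalOrder using () renaming (trans to <-trans)

  +-commutativeMonoid : CommutativeMonoid 0ℓ 0ℓ
  +-commutativeMonoid = record
    { Carrier = Carrier ; _≈_ = _≡_ ; _∙_ = _⊕_ ; ε = 0# ; isCommutativeMonoid = +-isCommutativeMonoid }

  open MonoidSum +-commutativeMonoid using (sum; sum-remove; ∑-distrib-+; sum-cong-≗; sum-replicate-zero)

  open ≡-Reasoning

  restrict : Bool → Carrier → Carrier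
  restrict c y = if c then y else 0#

  sumFin≡sum : ∀ {k} (f : Vect R k) → sumFin R f ≡ sum f
  sumFin≡sum {zero}  f = refl
  sumFin≡sum {suc k} f = cong (f Fin.zero ⊕_) (sumFin≡sum (f ∘ Fin.suc))

  sumFin-cong : ∀ {k} {f g : Vect R k} → (∀ i → f i ≡ g i) → sumFin R f ≡ sumFin R g
  sumFin-cong {f = f} {g} f≗g = trans (sumFin≡sum f) (trans (sum-cong-≗ f≗g) (sym (sumFin≡sum g)))

  sumFin-zero : ∀ {k} {f : Vect R k} → (∀ i → f i ≡ 0#) → sumFin R f ≡ 0#
  sumFin-zero {k} f≗0 = trans (sumFin-cong f≗0) (trans (sumFin≡sum (λ (_ : Fin k) → 0#)) (sum-replicate-zero k))

  sumFin-distrib : ∀ {k} (f g : Vect R k) → sumFin R (λ i → f i ⊕ g i) ≡ sumFin R f ⊕ sumFin R g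
  sumFin-distrib f g = begin
    sumFin R (λ i → f i ⊕ g i)  ≡⟨ sumFin≡sum (λ i → f i ⊕ g i) ⟩
    sum (λ i → f i ⊕ g i)       ≡⟨ ∑-distrib-+ f g ⟩
    sum f ⊕ sum g               ≡⟨ sym (cong₂ _⊕_ (sumFin≡sum f) (sumFin≡sum g)) ⟩
    sumFin R f ⊕ sumFin R g     ∎

  sum-single : ∀ {k} (f : Vect R k) i → (∀ j → j ≢ i → f j ≡ 0#) → sumFin R f ≡ f i
  sum-single {suc k} f i vanish = begin
    sumFin R f                           ≡⟨ sumFin≡sum f ⟩
    sum f                                ≡⟨ sum-remove {i = i} f ⟩
    f i ⊕ sum (Vector.removeAt f i)      ≡⟨ cong (f i ⊕_) (sum-cong-≗ (λ j → vanish _ (punchInᵢ≢i i j))) ⟩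
    f i ⊕ sum {k} (λ _ → 0#)             ≡⟨ cong (f i ⊕_) (sum-replicate-zero k) ⟩
    f i ⊕ 0#                             ≡⟨ +-identityʳ _ ⟩
    f i                                  ∎

  sum-split : ∀ m n (f : Vect R (m + n)) → sumFin R f ≡ sumFin R (f ∘ (_↑ˡ n)) ⊕ sumFin R (f ∘ (m ↑ʳ_))
  sum-split zero    n f = sym (+-identityˡ _)
  sum-split (suc m) n f = trans (cong (f Fin.zero ⊕_) (sum-split m n (f ∘ Fin.suc))) (sym (+-assoc _ _ _))

  intervalSum-cong : ∀ {k} {v u : Vect R k} A B → _≋_ R v u → intervalSum R v A B ≡ intervalSum R u A B
  intervalSum-cong A B v≋u = sumFin-cong (λ j → cong (restrict (χ A B (toℕ j))) (v≋u j))

  intervalSum-unit : ∀ {k} (v : Vect R k) (i : Fin k) {A} → toℕ i ≡ A → intervalSum R v A (suc A) ≡ v i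
  intervalSum-unit v i refl =
    trans (sum-single _ i outside) (cong (λ c → restrict c (v i)) (χ-inside (toℕ i) (suc (toℕ i)) ≤-refl ≤-refl))
    where
    outside : ∀ j → j ≢ i → restrict (χ (toℕ i) (suc (toℕ i)) (toℕ j)) (v j) ≡ 0#
    outside j j≢i with <-cmp (toℕ j) (toℕ i)
    ... | tri< j<i _ _ = cong (λ c → restrict c (v j)) (χ-below (toℕ i) (suc (toℕ i)) j<i)
    ... | tri≈ _ j≡i _ = ⊥-elim (j≢i (toℕ-injective j≡i))
    ... | tri> _ _ i<j = cong (λ c → restrict c (v j)) (χ-above (toℕ i) (suc (toℕ i)) i<j)

  intervalSum-concat : ∀ {k} (v : Vect R k) {A B C} → A ≤ B → B ≤ C →
    intervalSum R v A C ≡ intervalSum R v A B ⊕ intervalSum R v B C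
  intervalSum-concat v {A} {B} {C} A≤B B≤C =
    trans (sumFin-cong split-at-B) (sumFin-distrib (λ j → restrict (χ A B (toℕ j)) (v j)) (λ j → restrict (χ B C (toℕ j)) (v j)))
    where
    -- each coordinate lies in at most one of [A, B) and [B, C)
    split-at-B : ∀ j → restrict (χ A C (toℕ j)) (v j) ≡ restrict (χ A B (toℕ j)) (v j) ⊕ restrict (χ B C (toℕ j)) (v j)
    split-at-B j with toℕ j <? B
    ... | yes x<B rewrite χ-same-right {A} x<B (<-≤-trans x<B B≤C) | χ-below B C x<B = sym (+-identityʳ _)
    ... | no x≮B  rewrite sym (χ-same-left {C = C} (≤-trans A≤B (≮⇒≥ x≮B)) (≮⇒≥ x≮B)) | χ-above A B (≮⇒≥ x≮B) =
      sym (+-identityˡ _)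

  intervalSum-proj : ∀ {m} n (w : Vect R (m + n)) A {B} → B ≤ m → intervalSum R w A B ≡ intervalSum R (proj R n w) A B
  intervalSum-proj {m} n w A {B} B≤m = begin
    intervalSum R w A B
      ≡⟨ sum-split m n _ ⟩
    sumFin R (λ i → restrict (χ A B (toℕ (i ↑ˡ n))) (w (i ↑ˡ n))) ⊕ sumFin R (λ k → restrict (χ A B (toℕ (m ↑ʳ k))) (w (m ↑ʳ k)))
      ≡⟨ cong₂ _⊕_ (sumFin-cong (λ i → cong (λ x → restrict (χ A B x) (w (i ↑ˡ n))) (toℕ-↑ˡ i n)))
                   (sumFin-zero (λ k → cong (λ c → restrict c (w (m ↑ʳ k))) (χ-above A B (≤-trans B≤m (m≤toℕ-↑ʳ k))))) ⟩
    intervalSum R (proj R n w) A B ⊕ 0#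
      ≡⟨ +-identityʳ _ ⟩
    intervalSum R (proj R n w) A B
      ∎
    where
    m≤toℕ-↑ʳ : ∀ k → m ≤ toℕ (m ↑ʳ k)
    m≤toℕ-↑ʳ k = ≤-trans (m≤m+n m _) (≤-reflexive (sym (toℕ-↑ʳ m k)))

  unit-tuple : ∀ {k} (v : Vect R k) {i j : Fin k} {A A'} → toℕ i ≡ A → toℕ j ≡ A' →
    SatisfiesTuple R v (tup A' (suc A') A (suc A)) ⇔ (v i ≡ v j)
  unit-tuple v {i} {j} i≡A j≡A' = mk⇔
    (λ s → trans (sym (intervalSum-unit v i i≡A)) (trans s (intervalSum-unit v j j≡A')))
    (λ e → trans (intervalSum-unit v i i≡A) (trans e (sym (intervalSum-unit v j j≡A'))))

  sum-tuple : ∀ {k} (v : Vect R k) {i j l : Fin k} {A} → toℕ i ≡ A → toℕ j ≡ suc A → toℕ l ≡ suc (suc A) →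
    SatisfiesTuple R v (tup A (suc (suc A)) (suc (suc A)) (suc (suc (suc A)))) ⇔ (v l ≡ v i ⊕ v j)
  sum-tuple v {i} {j} {l} {A} i≡A j≡A+1 l≡A+2 = mk⇔
    (λ s → trans (sym (intervalSum-unit v l l≡A+2)) (trans s pair))
    (λ e → trans (intervalSum-unit v l l≡A+2) (trans e (sym pair)))
    where
    pair : intervalSum R v A (suc (suc A)) ≡ v i ⊕ v j
    pair = trans (intervalSum-concat v (n≤1+n A) (n≤1+n (suc A)))
                 (cong₂ _⊕_ (intervalSum-unit v i i≡A) (intervalSum-unit v j j≡A+1))

  satisfies-proj : ∀ {m} n (w : Vect R (m + n)) t → AdmissibleIn R m t →
    SatisfiesTuple R w t ⇔ SatisfiesTuple R (proj R n w) t
  satisfies-proj n w (tup a' b' a b) (_ , _ , _ , _ , _ , b'≤m , _ , b≤m) = mk⇔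
    (λ s → trans (sym (intervalSum-proj n w a b≤m)) (trans s (intervalSum-proj n w a' b'≤m)))
    (λ s → trans (intervalSum-proj n w a b≤m) (trans s (sym (intervalSum-proj n w a' b'≤m))))

  all-satisfy-proj : ∀ {m} n (w : Vect R (m + n)) {I} → All (AdmissibleIn R m) I →
    All (SatisfiesTuple R w) I ⇔ All (SatisfiesTuple R (proj R n w) ) I
  all-satisfy-proj n w admI = mk⇔
    (λ sI → All.zipWith (λ {t} (adm , s) → to (satisfies-proj n w t adm) s) (admI , sI))
    (λ sI → All.zipWith (λ {t} (adm , s) → from (satisfies-proj n w t adm) s) (admI , sI))

  satisfies-cong : ∀ {k} {v u : Vect R k} t → _≋_ R v u → SatisfiesTuple R v t → SatisfiesTuple R u t
  satisfies-cong (tup a' b' a b) v≋u s =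
    trans (sym (intervalSum-cong a b v≋u)) (trans s (intervalSum-cong a' b' v≋u))

  admissible-weaken : ∀ {m} n {t} → AdmissibleIn R m t → AdmissibleIn R (m + n) t
  admissible-weaken {m} n (a<b , a'<b' , a'<a , b'<b , a'≤m , b'≤m , a≤m , b≤m) =
    a<b , a'<b' , a'<a , b'<b , widen a'≤m , widen b'≤m , widen a≤m , widen b≤m
    where
    widen : ∀ {x} → x ≤ m → x ≤ m + n
    widen x≤m = ≤-trans x≤m (m≤m+n m n)

  Cut : ∀ k → List (Tuple R) → Vect R k → Set
  Cut k I v = Positive R v × All (SatisfiesTuple R v) I

  cut-intervallic : ∀ {k I} → All (AdmissibleIn R k) I → IsIntervallic R k (Cut k I)
  cut-intervallic {I = I} admI = I , admI , λ v → (λ c → c) , (λ c → c)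

  ≋-blocks : ∀ {m n} {v w : Vect R (m + n)} → _≋_ R (proj R n v) (proj R n w) →
    (∀ k → v (m ↑ʳ k) ≡ w (m ↑ʳ k)) → _≋_ R v w
  ≋-blocks {m} {n} {v} {w} same-left same-right i = subst (λ i → v i ≡ w i) (join-splitAt m n i) (by-block (splitAt m i))
    where
    by-block : ∀ s → v (join m n s) ≡ w (join m n s)
    by-block (inj₁ j) = same-left j
    by-block (inj₂ k) = same-right k

  positive-++ : ∀ {m n} {u : Vect R m} {t : Vect R n} → Positive R u → Positive R t → Positive R (u Vector.++ t)
  positive-++ {m} pu pt i with splitAt m i
  ... | inj₁ j = pu j
  ... | inj₂ k = pt k

  +-positive : ∀ {x y} → 0# <ᴿ x → 0# <ᴿ y → 0# <ᴿ x ⊕ y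
  +-positive {x} {y} 0<x 0<y = <-trans 0<y (subst (_<ᴿ x ⊕ y) (+-identityˡ y) (+-monoˡ-< y 0<x))

  module Extension (m : ℕ) (I : List (Tuple R)) (admI : All (AdmissibleIn R m) I) (a b : Fin m) where

    new : Fin 3 → Fin (m + 3)
    new k = m ↑ʳ k

    -- stated with toℕ k + m, which reduces to m, suc m, suc (suc m)
    toℕ-new : ∀ k → toℕ (new k) ≡ toℕ k + m
    toℕ-new k = trans (toℕ-↑ʳ m k) (+-comm m (toℕ k))

    appended : Vect R m → Vect R 3
    appended u Fin.zero                     = u a
    appended u (Fin.suc Fin.zero)           = u b
    appended u (Fin.suc (Fin.suc Fin.zero)) = u a ⊕ u b

    appended-cong : ∀ {u u'} → _≋_ R u u' → _≋_ R (appended u) (appended u')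
    appended-cong u≋u' Fin.zero                     = u≋u' a
    appended-cong u≋u' (Fin.suc Fin.zero)           = u≋u' b
    appended-cong u≋u' (Fin.suc (Fin.suc Fin.zero)) = cong₂ _⊕_ (u≋u' a) (u≋u' b)

    appended-positive : ∀ {u} → Positive R u → Positive R (appended u)
    appended-positive pos Fin.zero                     = pos a
    appended-positive pos (Fin.suc Fin.zero)           = pos b
    appended-positive pos (Fin.suc (Fin.suc Fin.zero)) = +-positive (pos a) (pos b)

    extend : Vect R m → Vect R (m + 3)
    extend u = u Vector.++ appended u

    proj-extend : ∀ u → _≋_ R (proj R 3 (extend u)) u
    proj-extend u = lookup-++ˡ u (appended u)

    -- v_m = v_a,  v_{m+1} = v_b,  v_{m+2} = v_m + v_{m+1}
    newTuples : List (Tuple R)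
    newTuples = tup (toℕ a) (suc (toℕ a)) m (suc m)
              ∷ tup (toℕ b) (suc (toℕ b)) (suc m) (suc (suc m))
              ∷ tup m (suc (suc m)) (suc (suc m)) (suc (suc (suc m)))
              ∷ []

    -- Entries of the new tuples are most easily bounded by 3 + m = m + 3.
    swap-bound : ∀ {t} → AdmissibleIn R (3 + m) t → AdmissibleIn R (m + 3) t
    swap-bound {t} = subst (λ k → AdmissibleIn R k t) (+-comm 3 m)

    unit-admissible : ∀ (c : Fin m) j → j < 3 → AdmissibleIn R (3 + m) (tup (toℕ c) (suc (toℕ c)) (j + m) (suc (j + m)))
    unit-admissible c j j<3 =
      ≤-refl , ≤-refl , c<j+m , s≤s c<j+m , ≤-trans (<⇒≤ c<m) (m≤n+m m 3) , ≤-trans c<m (m≤n+m m 3) ,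
      ≤-trans (n≤1+n (j + m)) last≤ , last≤
      where
      c<m : toℕ c < m
      c<m = toℕ<n c
      c<j+m : toℕ c < j + m
      c<j+m = <-≤-trans c<m (m≤n+m m j)
      last≤ : suc (j + m) ≤ 3 + m
      last≤ = +-monoˡ-≤ m j<3

    sum-admissible : AdmissibleIn R (3 + m) (tup m (suc (suc m)) (suc (suc m)) (suc (suc (suc m))))
    sum-admissible = ≤-refl , m<2+m , m<2+m , ≤-refl , m≤n+m m 3 , n≤1+n _ , n≤1+n _ , ≤-refl
      where
      m<2+m : m < suc (suc m)
      m<2+m = s≤s (n≤1+n m)

    newTuples-admissible : All (AdmissibleIn R (m + 3)) newTuples
    newTuples-admissible = All.map swap-bound
      (unit-admissible a 0 (s≤s z≤n) ∷ unit-admissible b 1 (s≤s (s≤s z≤n)) ∷ sum-admissible ∷ [])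

    S' : Vect R (m + 3) → Set
    S' = Cut (m + 3) (newTuples ++ I)

    S'-intervallic : IsIntervallic R (m + 3) S'
    S'-intervallic = cut-intervallic (++⁺ newTuples-admissible (All.map (admissible-weaken 3) admI))

    HasAppended : Vect R (m + 3) → Set
    HasAppended v = ∀ k → v (new k) ≡ appended (proj R 3 v) k

    newTuples⇔appended : ∀ v → All (SatisfiesTuple R v) newTuples ⇔ HasAppended v
    newTuples⇔appended v = mk⇔ to-appended from-appended
      where
      first  = unit-tuple v (toℕ-new Fin.zero) (toℕ-↑ˡ a 3)
      second = unit-tuple v (toℕ-new (Fin.suc Fin.zero)) (toℕ-↑ˡ b 3)
      third  = sum-tuple v (toℕ-new Fin.zero) (toℕ-new (Fin.suc Fin.zero)) (toℕ-new (Fin.suc (Fin.suc Fin.zero)))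

      to-appended : All (SatisfiesTuple R v) newTuples → HasAppended v
      to-appended (s₁ ∷ s₂ ∷ s₃ ∷ []) Fin.zero                     = to first s₁
      to-appended (s₁ ∷ s₂ ∷ s₃ ∷ []) (Fin.suc Fin.zero)           = to second s₂
      to-appended (s₁ ∷ s₂ ∷ s₃ ∷ []) (Fin.suc (Fin.suc Fin.zero)) =
        trans (to third s₃) (cong₂ _⊕_ (to first s₁) (to second s₂))

      from-appended : HasAppended v → All (SatisfiesTuple R v) newTuples
      from-appended e = from first (e Fin.zero) ∷ from second (e (Fin.suc Fin.zero))
        ∷ from third (trans (e (Fin.suc (Fin.suc Fin.zero))) (sym (cong₂ _⊕_ (e Fin.zero) (e (Fin.suc Fin.zero))))) ∷ []

    unpack : ∀ {v} → S' v → Positive R v × HasAppended v × All (SatisfiesTuple R v) I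
    unpack {v} (pos , s) = pos , to (newTuples⇔appended v) (++⁻ˡ newTuples s) , ++⁻ʳ newTuples s

    pack : ∀ {v} → Positive R v → HasAppended v → All (SatisfiesTuple R v) I → S' v
    pack {v} pos e sI = pos , ++⁺ (from (newTuples⇔appended v) e) sI

    proj-into : ∀ {v} → S' v → Cut m I (proj R 3 v)
    proj-into {v} s with unpack s
    ... | pos , _ , sI = (λ i → pos (i ↑ˡ 3)) , to (all-satisfy-proj 3 v admI) sI

    proj-injective : ∀ {v w} → S' v → S' w → _≋_ R (proj R 3 v) (proj R 3 w) → _≋_ R v w
    proj-injective sv sw same with unpack sv | unpack sw
    ... | _ , appended-v , _ | _ , appended-w , _ =
      ≋-blocks same (λ k → trans (appended-v k) (trans (appended-cong same k) (sym (appended-w k))))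

    extend-into : ∀ {u} → Cut m I u → S' (extend u)
    extend-into {u} (pos , sI) = pack (positive-++ pos (appended-positive pos)) appended-extend
      (from (all-satisfy-proj 3 (extend u) admI) (All.map (λ {t} → satisfies-cong t (sym ∘ proj-extend u)) sI))
      where
      appended-extend : HasAppended (extend u)
      appended-extend k = trans (lookup-++ʳ u (appended u) k) (sym (appended-cong (proj-extend u) k))

    last-coordinate : ∀ {v} → S' v → v (new (Fin.suc (Fin.suc Fin.zero))) ≡ v (a ↑ˡ 3) ⊕ v (b ↑ˡ 3)
    last-coordinate s with unpack s
    ... | _ , appended-v , _ = appended-v (Fin.suc (Fin.suc Fin.zero))

-- S is Cut m I for an admissible I, and the extension S' of Cut m I does the
-- job.
lemma5p2p1 : (R : RealNumbers) →
    (m : ℕ) → 1 ≤ m → (S : Vect R m → Set) → IsIntervallic R m S →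
    (a b : Fin m) →
    Σ (Vect R (m + 3) → Set) λ S' → IsIntervallic R (m + 3) S' ×
      (∀ v → S' v → S (proj R 3 v)) ×
      (∀ v w → S' v → S' w → _≋_ R (proj R 3 v) (proj R 3 w) → _≋_ R v w) ×
      (∀ u → S u → Σ (Vect R (m + 3)) λ v → S' v × _≋_ R (proj R 3 v) u) ×
      (∀ v → S' v → v (m ↑ʳ Fin.suc (Fin.suc Fin.zero)) ≡ RealNumbers._+_ R (v (a ↑ˡ 3)) (v (b ↑ˡ 3)))
lemma5p2p1 R m _ S (I , admI , S⇔Cut) a b =
  S' , S'-intervallic ,
  (λ v s → proj₂ (S⇔Cut (proj R 3 v)) (proj-into s)) ,
  (λ v w → proj-injective) ,
  (λ u su → extend u , extend-into (proj₁ (S⇔Cut u) su) , proj-extend u) ,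
  (λ v → last-coordinate)
  where open Extension R m I admI a b
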